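{- Let $\mathfrak{F}=\langle W,R\rangle$ be any directed graph (a set $W$ with a binary relation $R$), let $n\in\omega$ and let $u$ be an ultrafilter over $W$. If $\{w\in W:\deg^+(w)\leq n\}\in u$, then $\deg^+(u)\leq n$, where $\deg^+(u)$ is computed in the ultrafilter extension $\mathfrak{F}^{\mathfrak{ue}}$.
   Context: For $X\subseteq W$ let $R^-(X)=\{w\in W:\exists s\,(Rws\wedge s\in X)\}$. The ultrafilter extension of $\mathfrak{F}$ is $\mathfrak{F}^{\mathfrak{ue}}=\langle \mathrm{Uf}(W),R^{\mathfrak{ue}}\rangle$, where $\mathrm{Uf}(W)$ is the set of all ultrafilters over $W$ and $R^{\mathfrak{ue}}uv$ holds iff $R^-(X)\in u$ for every $X\in v$. For a vertex $x$ of a graph with relation $S$, $\deg^+(x)=|\{y: Sxy\}|$ (out-degree); in $\mathfrak{F}$ we use $R$, in $\mathfrak{F}^{\mathfrak{ue}}$ we use $R^{\mathfrak{ue}}$. -}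

module Defs where

open import Data.Nat using (ℕ; suc)
open import Data.Fin using (Fin)
open import Data.Product using (Σ; _×_; ∃)
open import Data.Sum using (_⊎_)
open import Data.Empty using (⊥)
open import Data.Unit using (⊤)
open import Relation.Nullary using (¬_)
open import Relation.Binary.PropositionalEquality using (_≡_; _≢_)

Subset : Set → Set₁
Subset W = W → Set

_⊆_ : {W : Set} → Subset W → Subset W → Set
X ⊆ Y = ∀ w → X w → Y w

_∩_ : {W : Set} → Subset W → Subset W → Subset W
(X ∩ Y) w = X w × Y w

∁ : {W : Set} → Subset W → Subset W
∁ X w = ¬ X w

record Ultrafilter (W : Set) : Set₁ where
  field
    _∈U       : Subset W → Set
    full      : (λ _ → ⊤) ∈U
    upward    : ∀ {X Y} → X ⊆ Y → X ∈U → Y ∈U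
    intersect : ∀ {X Y} → X ∈U → Y ∈U → (X ∩ Y) ∈U
    proper    : ¬ ((λ _ → ⊥) ∈U)
    ultra     : ∀ X → X ∈U ⊎ (∁ X) ∈U
open Ultrafilter public

_≈U_ : {W : Set} → Ultrafilter W → Ultrafilter W → Set₁
u ≈U v = ∀ X → ((u ∈U) X → (v ∈U) X) × ((v ∈U) X → (u ∈U) X)

R⁻ : {W : Set} → (W → W → Set) → Subset W → Subset W
R⁻ R X w = Σ _ λ s → R w s × X s

Rᵘᵉ : {W : Set} → (W → W → Set) → Ultrafilter W → Ultrafilter W → Set₁
Rᵘᵉ R u v = ∀ X → (v ∈U) X → (u ∈U) (R⁻ R X)

-- "The set {y : S x y} has at most n elements" (cardinality ≤ n),
-- relative to an equality _≈_ on the carrier: there are no n+1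
-- pairwise distinct S-successors of x.
OutDeg≤ : ∀ {a ℓ r} {A : Set a} → (A → A → Set ℓ) → (A → A → Set r) → A → ℕ → Set _
OutDeg≤ {A = A} _≈_ S x n =
  ¬ (Σ (Fin (suc n) → A) λ f →
       (∀ i → S x (f i)) × (∀ i j → i ≢ j → ¬ (f i ≈ f j)))

{-# OPTIONS --safe #-}
module Submission where

-- Distinct ultrafilters are separated by some set, and finitely many separators can be
-- refined into pairwise disjoint sets Yᵢ ∈ vᵢ, one for each of n+1 distinct successors vᵢ
-- of u. Then every R⁻(Yᵢ) lies in u, hence some w of out-degree ≤ n lies in all of them,
-- and the successors of w witnessing w ∈ R⁻(Yᵢ) are pairwise distinct because the Yᵢ are
-- disjoint. Since the conclusion is a negation, the separators may be chosen under a
-- double negation, which keeps the argument constructive.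

open import Defs
open import Level using (Level)
open import Data.Nat using (ℕ; zero; suc)
open import Data.Fin using (Fin; zero; suc)
open import Data.Product using (Σ; _×_; _,_; proj₁; proj₂)
open import Data.Sum using (inj₁; inj₂)
open import Data.Empty using (⊥-elim)
open import Data.Unit using (⊤)
open import Function using (_∘_; const)
open import Relation.Nullary using (¬_; yes; no)
open import Relation.Nullary.Decidable using (¬¬-excluded-middle)
open import Relation.Binary.PropositionalEquality using (_≡_; _≢_; sym; subst)

private variable
  a b p : Level
  W : Set
  k : ℕ

-- OutDeg≤ _≈_ S x n unfolds to ¬ DistinctSuccessors _≈_ S x (suc n).
DistinctSuccessors : ∀ {a ℓ r} {A : Set a} → (A → A → Set ℓ) → (A → A → Set r) → A → ℕ → Set _
DistinctSuccessors {A = A} _≈_ S x k =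
  Σ (Fin k → A) λ f → (∀ i → S x (f i)) × (∀ i j → i ≢ j → ¬ (f i ≈ f j))

PairwiseDisjoint : (Fin k → Subset W) → Set
PairwiseDisjoint Y = ∀ i j → i ≢ j → ∀ s → Y i s → ¬ Y j s

¬¬-Π-Fin : {B : Fin k → Set a} → (∀ i → ¬ ¬ B i) → ¬ ¬ (∀ i → B i)
¬¬-Π-Fin {k = zero}  h c = c λ ()
¬¬-Π-Fin {k = suc k} h c =
  h zero λ b₀ → ¬¬-Π-Fin (h ∘ suc) λ bs → c λ { zero → b₀ ; (suc i) → bs i }

¬¬-independence-of-premise : {A : Set a} {B : Set b} {P : A → Set p} →
                             A → (B → ¬ ¬ Σ A P) → ¬ ¬ Σ A (λ x → B → P x)
¬¬-independence-of-premise x₀ h c = ¬¬-excluded-middle λ where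
  (yes b) → h b λ (x , px) → c (x , const px)
  (no ¬b) → c (x₀ , λ b → ⊥-elim (¬b b))

module _ (v : Ultrafilter W) where

  ∈U⇒∁∉U : {X : Subset W} → (v ∈U) X → ¬ (v ∈U) (∁ X)
  ∈U⇒∁∉U X∈v ∁X∈v = proper v (upward v (λ _ (x , ¬x) → ¬x x) (intersect v X∈v ∁X∈v))

  ∉U⇒∁∈U : {X : Subset W} → ¬ (v ∈U) X → (v ∈U) (∁ X)
  ∉U⇒∁∈U {X} X∉v with ultra v X
  ... | inj₁ X∈v  = ⊥-elim (X∉v X∈v)
  ... | inj₂ ∁X∈v = ∁X∈v

  ∈U-stable : {X : Subset W} → ¬ ¬ (v ∈U) X → (v ∈U) X
  ∈U-stable {X} ¬¬X∈v with ultra v X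
  ... | inj₁ X∈v  = X∈v
  ... | inj₂ ∁X∈v = ⊥-elim (¬¬X∈v λ X∈v → ∈U⇒∁∉U X∈v ∁X∈v)

  ∈U-nonempty : {X : Subset W} → (v ∈U) X → ¬ ¬ Σ W X
  ∈U-nonempty X∈v ¬∃ = proper v (upward v (λ w x → ¬∃ (w , x)) X∈v)

  ∈U-⋂ : {A : Fin k → Subset W} → (∀ i → (v ∈U) (A i)) → (v ∈U) (λ s → ∀ i → A i s)
  ∈U-⋂ {k = zero}  h = upward v (λ _ _ ()) (full v)
  ∈U-⋂ {k = suc k} h =
    upward v (λ _ (a₀ , as) → λ { zero → a₀ ; (suc i) → as i })
      (intersect v (h zero) (∈U-⋂ (h ∘ suc)))

  ∈U-guarded : {P : Set} {X : Subset W} → (P → (v ∈U) X) → (v ∈U) (λ s → P → X s)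
  ∈U-guarded h = ∈U-stable λ ¬guarded∈v → ¬¬-excluded-middle λ where
    (yes p) → ¬guarded∈v (upward v (λ _ x _ → x) (h p))
    (no ¬p) → ¬guarded∈v (upward v (λ _ _ p → ⊥-elim (¬p p)) (full v))

≉U⇒¬¬separable : (u v : Ultrafilter W) → ¬ (u ≈U v) →
                 ¬ ¬ Σ (Subset W) λ X → (u ∈U) X × ¬ (v ∈U) X
≉U⇒¬¬separable u v u≉v noSeparator = u≉v λ X → u⇒v , v⇒u
  where
  u⇒v : ∀ {X} → (u ∈U) X → (v ∈U) X
  u⇒v {X} X∈u = ∈U-stable v λ X∉v → noSeparator (X , X∈u , X∉v)
  v⇒u : ∀ {X} → (v ∈U) X → (u ∈U) X
  v⇒u {X} X∈v = ∈U-stable u λ X∉u → noSeparator (∁ X , ∉U⇒∁∈U u X∉u , ∈U⇒∁∉U v X∈v)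

module _ (f : Fin k → Ultrafilter W) where

  Separators : (Fin k → Fin k → Subset W) → Set
  Separators X = ∀ i j → i ≢ j → (f i ∈U) (X i j) × ¬ (f j ∈U) (X i j)

  DisjointMembers : Set₁
  DisjointMembers = Σ (Fin k → Subset W) λ Y → (∀ i → (f i ∈U) (Y i)) × PairwiseDisjoint Y

  separators⇒disjointMembers : {X : Fin k → Fin k → Subset W} → Separators X → DisjointMembers
  separators⇒disjointMembers {X} separates = Y , Y∈f , disjoint
    where
    Y : Fin k → Subset W
    Y i s = ∀ j → i ≢ j → X i j s × ¬ X j i s
    Y∈f : ∀ i → (f i ∈U) (Y i)
    Y∈f i = ∈U-⋂ (f i) λ j → ∈U-guarded (f i) λ i≢j →
      intersect (f i) (proj₁ (separates i j i≢j))
                      (∉U⇒∁∈U (f i) (proj₂ (separates j i (i≢j ∘ sym))))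
    disjoint : PairwiseDisjoint Y
    disjoint i j i≢j s Yᵢs Yⱼs = proj₂ (Yⱼs i (i≢j ∘ sym)) (proj₁ (Yᵢs j i≢j))

  distinct⇒¬¬disjointMembers : (∀ i j → i ≢ j → ¬ (f i ≈U f j)) → ¬ ¬ DisjointMembers
  distinct⇒¬¬disjointMembers distinct noMembers =
    ¬¬-Π-Fin (λ i → ¬¬-Π-Fin (separator i)) λ sep →
      noMembers (separators⇒disjointMembers (λ i j → proj₂ (sep i j)))
    where
    separator : ∀ i j → ¬ ¬ Σ (Subset W) λ X → i ≢ j → (f i ∈U) X × ¬ (f j ∈U) X
    separator i j = ¬¬-independence-of-premise (λ _ → ⊤) λ i≢j →
      ≉U⇒¬¬separable (f i) (f j) (distinct i j i≢j)

R⁻-disjoint⇒distinctSuccessors : (R : W → W → Set) {Y : Fin k → Subset W} {w : W} →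
  PairwiseDisjoint Y → (∀ i → R⁻ R (Y i) w) → DistinctSuccessors _≡_ R w k
R⁻-disjoint⇒distinctSuccessors R {Y} disjoint w∈R⁻Y =
  proj₁ ∘ w∈R⁻Y , proj₁ ∘ proj₂ ∘ w∈R⁻Y , λ i j i≢j sᵢ≡sⱼ →
    disjoint i j i≢j _ (proj₂ (proj₂ (w∈R⁻Y i)))
      (subst (Y j) (sym sᵢ≡sⱼ) (proj₂ (proj₂ (w∈R⁻Y j))))

proposition3p1 : (W : Set) (R : W → W → Set) (n : ℕ) (u : Ultrafilter W) →
    (u ∈U) (λ w → OutDeg≤ _≡_ R w n) →
    OutDeg≤ _≈U_ (Rᵘᵉ R) u n
proposition3p1 W R n u degree≤n∈u (f , uRf , distinct) =
  distinct⇒¬¬disjointMembers f distinct λ (Y , Y∈f , disjoint) →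
  ∈U-nonempty u (intersect u degree≤n∈u (∈U-⋂ u λ i → uRf i (Y i) (Y∈f i)))
    λ (w , degree≤n , w∈R⁻Y) →
  degree≤n (R⁻-disjoint⇒distinctSuccessors R disjoint w∈R⁻Y)
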